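{- Let $A$ and $B$ be finite totally ordered sets and $x:A\to B$ a monotone non-decreasing map. Let $S\subseteq\{(a,x(a)): a\in A\}$ be a non-empty set of pairs no two of which share a coordinate. Then there exists a monotone non-decreasing map $y:B\to A$ such that $\{(a,b)\in A\times B: x(a)=b,\ y(b)=a\}=S$. -}

module Defs where

open import Data.Nat using (ℕ)
open import Data.Fin using (Fin; _≤_)

Monotone : {m n : ℕ} → (Fin m → Fin n) → Set
Monotone {m} f = (a a′ : Fin m) → a ≤ a′ → f a ≤ f a′

-- Call a ∈ A selected if (a, x a) ∈ S. Put y b := the greatest selected a with x a ≤ b,
-- or the least selected a if there is none. Then y is monotone because the set it
-- maximises grows with b, and y b is always selected, so x a ≡ b and y b ≡ a force
-- (a, b) ∈ S. Conversely, for (a, b) ∈ S we get a ≤ y b, hence b ≡ x a ≤ x (y b) ≤ b;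
-- so (y b, b) ∈ S as well, and y b ≡ a since no two pairs of S share b.
module Submission where

open import Defs
open import Data.Nat using (ℕ; zero; suc; z≤n; s≤s)
open import Data.Fin using (Fin; _≤_; _≤?_) renaming (zero to fzero; suc to fsuc)
open import Data.Fin.Properties using (≤-trans; ≤-antisym; ≤-reflexive)
open import Data.Product using (Σ; ∃; _×_; _,_; proj₁; proj₂)
open import Data.Sum using (_⊎_; inj₁; inj₂)
open import Data.Empty using (⊥-elim)
open import Level using (Level)
open import Relation.Nullary using (yes; no)
open import Relation.Nullary.Decidable using (_×-dec_)
open import Relation.Binary.PropositionalEquality using (_≡_; refl; sym; subst)
open import Relation.Binary.Definitions using (Decidable)
open import Relation.Unary using (Pred; Empty; _⊆_)
import Relation.Unary as U

module _ {p : Level} {m : ℕ} where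

  Greatest : Pred (Fin m) p → Fin m → Set p
  Greatest P a = P a × (∀ a′ → P a′ → a′ ≤ a)

  Least : Pred (Fin m) p → Fin m → Set p
  Least P a = P a × (∀ a′ → P a′ → a ≤ a′)

  greatest-mono : {P Q : Pred (Fin m) p} {a b : Fin m} →
    P ⊆ Q → Greatest P a → Greatest Q b → a ≤ b
  greatest-mono P⊆Q (Pa , _) (_ , b-greatest) = b-greatest _ (P⊆Q Pa)

greatest? : ∀ {p m} {P : Pred (Fin m) p} → U.Decidable P → Empty P ⊎ ∃ (Greatest P)
greatest? {m = zero} P? = inj₁ λ ()
greatest? {m = suc m} P? with greatest? (λ a → P? (fsuc a))
... | inj₂ (a , Pa , greatest) =
  inj₂ (fsuc a , Pa , λ { fzero _ → z≤n ; (fsuc a′) Pa′ → s≤s (greatest a′ Pa′) })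
... | inj₁ none with P? fzero
...   | yes P0 = inj₂ (fzero , P0 , λ { fzero _ → z≤n ; (fsuc a′) Pa′ → ⊥-elim (none a′ Pa′) })
...   | no ¬P0 = inj₁ λ { fzero P0 → ¬P0 P0 ; (fsuc a′) Pa′ → none a′ Pa′ }

least? : ∀ {p m} {P : Pred (Fin m) p} → U.Decidable P → Empty P ⊎ ∃ (Least P)
least? {m = zero} P? = inj₁ λ ()
least? {m = suc m} P? with P? fzero
... | yes P0 = inj₂ (fzero , P0 , λ _ _ → z≤n)
... | no ¬P0 with least? (λ a → P? (fsuc a))
...   | inj₂ (a , Pa , least) =
  inj₂ (fsuc a , Pa , λ { fzero P0 → ⊥-elim (¬P0 P0) ; (fsuc a′) Pa′ → s≤s (least a′ Pa′) })
...   | inj₁ none = inj₁ λ { fzero P0 → ¬P0 P0 ; (fsuc a′) Pa′ → none a′ Pa′ }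

module MonotoneInverse
    {m n : ℕ} (x : Fin m → Fin n) (x-mono : Monotone x)
    (S : Fin m → Fin n → Set) (S? : Decidable S)
    (S⊆graph : ∀ a b → S a b → x a ≡ b)
    (S-nonempty : Σ (Fin m) λ a → Σ (Fin n) λ b → S a b)
    (S-injective : ∀ a a′ b b′ → S a b → S a′ b′ → b ≡ b′ → a ≡ a′)
  where

  Selected : Pred (Fin m) _
  Selected a = S a (x a)

  SelectedUpTo : Fin n → Pred (Fin m) _
  SelectedUpTo b a = Selected a × x a ≤ b

  S⇒Selected : ∀ {a b} → S a b → Selected a
  S⇒Selected {a} {b} s = subst (S a) (sym (S⊆graph a b s)) s

  S⇒SelectedUpTo : ∀ {a b} → S a b → SelectedUpTo b a
  S⇒SelectedUpTo {a} {b} s = S⇒Selected s , ≤-reflexive (S⊆graph a b s)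

  firstSelected : ∃ (Least Selected)
  firstSelected with least? (λ a → S? a (x a))
  ... | inj₂ first = first
  ... | inj₁ none = ⊥-elim (none _ (S⇒Selected (proj₂ (proj₂ S-nonempty))))

  Choice : Fin n → Set
  Choice b = Empty (SelectedUpTo b) ⊎ ∃ (Greatest (SelectedUpTo b))

  choice : ∀ b → Choice b
  choice b = greatest? (λ a → S? a (x a) ×-dec x a ≤? b)

  chosen : ∀ {b} → Choice b → Fin m
  chosen (inj₁ _) = proj₁ firstSelected
  chosen (inj₂ (a , _)) = a

  y : Fin n → Fin m
  y b = chosen (choice b)

  chosen-selected : ∀ {b} (c : Choice b) → Selected (chosen c)
  chosen-selected (inj₁ _) = proj₁ (proj₂ firstSelected)
  chosen-selected (inj₂ (_ , (sel , _) , _)) = sel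

  upTo-mono : ∀ {b b′} → b ≤ b′ → SelectedUpTo b ⊆ SelectedUpTo b′
  upTo-mono b≤b′ (sel , xa≤b) = sel , ≤-trans xa≤b b≤b′

  chosen-mono : ∀ {b b′} → b ≤ b′ → (c : Choice b) (c′ : Choice b′) → chosen c ≤ chosen c′
  chosen-mono _ (inj₁ _) c′ = proj₂ (proj₂ firstSelected) _ (chosen-selected c′)
  chosen-mono b≤b′ (inj₂ (a , upTo , _)) (inj₁ none) = ⊥-elim (none a (upTo-mono b≤b′ upTo))
  chosen-mono b≤b′ (inj₂ (_ , g)) (inj₂ (_ , g′)) = greatest-mono (upTo-mono b≤b′) g g′

  y-mono : Monotone y
  y-mono b b′ b≤b′ = chosen-mono b≤b′ (choice b) (choice b′)

  chosen-inverts-S : ∀ {a b} → S a b → (c : Choice b) → chosen c ≡ a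
  chosen-inverts-S s (inj₁ none) = ⊥-elim (none _ (S⇒SelectedUpTo s))
  chosen-inverts-S {a} {b} s (inj₂ (a* , (sel* , xa*≤b) , greatest)) =
    S-injective a* a (x a*) b sel* s xa*≡b
    where
    b≤xa* : b ≤ x a*
    b≤xa* = subst (_≤ x a*) (S⊆graph a b s) (x-mono a a* (greatest a (S⇒SelectedUpTo s)))

    xa*≡b : x a* ≡ b
    xa*≡b = ≤-antisym xa*≤b b≤xa*

  graph∩inverse⊆S : ∀ a b → x a ≡ b × y b ≡ a → S a b
  graph∩inverse⊆S a _ (refl , ya≡a) = subst Selected ya≡a (chosen-selected (choice (x a)))

  S⊆graph∩inverse : ∀ a b → S a b → x a ≡ b × y b ≡ a
  S⊆graph∩inverse a b s = S⊆graph a b s , chosen-inverts-S s (choice b)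

proposition5 : (m n : ℕ) (x : Fin m → Fin n) → Monotone x →
    (S : Fin m → Fin n → Set) → Decidable S →
    ((a : Fin m) (b : Fin n) → S a b → x a ≡ b) →
    (Σ (Fin m) λ a → Σ (Fin n) λ b → S a b) →
    ((a a′ : Fin m) (b b′ : Fin n) → S a b → S a′ b′ → a ≡ a′ → b ≡ b′) →
    ((a a′ : Fin m) (b b′ : Fin n) → S a b → S a′ b′ → b ≡ b′ → a ≡ a′) →
    Σ (Fin n → Fin m) λ y → Monotone y ×
      ((a : Fin m) (b : Fin n) → ((x a ≡ b × y b ≡ a) → S a b) × (S a b → (x a ≡ b × y b ≡ a)))
-- The hypothesis that no two pairs share a first coordinate is implied by S ⊆ graph x.
proposition5 m n x x-mono S S? S⊆graph S-nonempty _ S-injective =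
  y , y-mono , λ a b → graph∩inverse⊆S a b , S⊆graph∩inverse a b
  where open MonotoneInverse x x-mono S S? S⊆graph S-nonempty S-injective
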